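{- For $A\in\mathcal{PM}(n)$, $B\in\mathcal{PM}(m)$ and $i\in[n]$ define $$A\circ^{\max,\min}_i B=\begin{pmatrix}A_{11}&\mathbb{O}&\mathbb{O}\\ \mathrm{Max}_i(A,B)&B&\mathbb{O}\\ A_{21}&\mathrm{Min}_i(A,B)&A_{22}\end{pmatrix}.$$ Then $A\circ^{\max,\min}_i B$ is a poset matrix (an element of $\mathcal{PM}(n+m-1)$) for all $i\in[n]$.
   Context: A poset matrix of order $n$ is an $n\times n$ $(0,1)$-matrix $A=[a_{st}]$ that is lower triangular with all diagonal entries $1$ and transitive ($a_{st}=a_{tu}=1\Rightarrow a_{su}=1$); $\mathcal{PM}(n)$ is the set of these. The poset associated to $B=[b_{st}]\in\mathcal{PM}(m)$ is $[m]$ with $t\le s$ iff $b_{st}=1$. $A[\alpha\mid\beta]$ is the submatrix with rows $\alpha$ and columns $\beta$, $A[\alpha]=A[\alpha\mid\alpha]$. For $A\in\mathcal{PM}(n)$, $i\in[n]$: $A_{11}=A[\{1,\dots,i-1\}]$, $A_{22}=A[\{i+1,\dots,n\}]$, $A_{21}=A[\{i+1,\dots,n\}\mid\{1,\dots,i-1\}]$, $A_{(i)}=A[\{i\}\mid\{1,\dots,i-1\}]$ (row vector), $A^{(i)}=A[\{i+1,\dots,n\}\mid\{i\}]$ (column vector); empty blocks are vacuous. $\mathrm{Max}_i(A,B)$ is the $m\times(i-1)$ matrix whose $j$-th row is $A_{(i)}$ if $j$ is a maximal element of the poset associated to $B$ and zero otherwise; $\mathrm{Min}_i(A,B)$ is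 the $(n-i)\times m$ matrix whose $j$-th column is $A^{(i)}$ if $j$ is a minimal element of the poset associated to $B$ and zero otherwise. -}

module Defs where

open import Data.Nat using (ℕ; zero; suc; _+_; _∸_; _<_; _≤_)
open import Data.Nat.Properties using (_<?_)
open import Data.Fin using (Fin; toℕ; fromℕ<)
open import Data.Bool using (Bool; true; false; if_then_else_)
open import Relation.Binary.PropositionalEquality using (_≡_; _≢_)
open import Relation.Nullary using (yes; no)
open import Data.Product using (_×_)

Matrix : ℕ → Set
Matrix n = Fin n → Fin n → Bool

LowerTriangular : ∀ {n} → Matrix n → Set
LowerTriangular {n} A = ∀ (s t : Fin n) → A s t ≡ true → toℕ t ≤ toℕ s

UnitDiagonal : ∀ {n} → Matrix n → Set
UnitDiagonal {n} A = ∀ (s : Fin n) → A s s ≡ true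

Transitive : ∀ {n} → Matrix n → Set
Transitive {n} A = ∀ (s t u : Fin n) → A s t ≡ true → A t u ≡ true → A s u ≡ true

IsPosetMatrix : ∀ {n} → Matrix n → Set
IsPosetMatrix A = LowerTriangular A × UnitDiagonal A × Transitive A

-- In the poset associated to B: t ≤ s iff B s t = 1.
-- j is maximal: no s ≠ j with j ≤ s.
IsMaximal : ∀ {m} → Matrix m → Fin m → Set
IsMaximal {m} B j = ∀ (s : Fin m) → s ≢ j → B s j ≡ false

IsMinimal : ∀ {m} → Matrix m → Fin m → Set
IsMinimal {m} B j = ∀ (t : Fin m) → t ≢ j → B j t ≡ false

open import Relation.Nullary using (Dec; ¬_)
open import Relation.Nullary.Decidable using (¬?)
open import Relation.Nullary.Decidable using (_→-dec_; ⌊_⌋)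
open import Data.Fin.Properties using (all?; _≟_)
open import Data.Bool.Properties using () renaming (_≟_ to _≟ᵇ_)

isMaximal? : ∀ {m} (B : Matrix m) (j : Fin m) → Dec (IsMaximal B j)
isMaximal? B j = all? (λ s → ¬? (s ≟ j) →-dec (B s j ≟ᵇ false))

isMinimal? : ∀ {m} (B : Matrix m) (j : Fin m) → Dec (IsMinimal B j)
isMinimal? B j = all? (λ t → ¬? (t ≟ j) →-dec (B j t ≟ᵇ false))

-- Entry lookup of a square matrix at natural-number (0-based) positions;
-- out-of-range positions give false (never used in range-correct calls).
at : ∀ {n} → Matrix n → ℕ → ℕ → Bool
at {n} A s t with s <? n | t <? n
... | yes s<n | yes t<n = A (fromℕ< s<n) (fromℕ< t<n)
... | _ | _ = false

maxAt : ∀ {m} → Matrix m → ℕ → Bool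
maxAt {m} B j with j <? m
... | yes j<m = ⌊ isMaximal? B (fromℕ< j<m) ⌋
... | no _ = false

minAt : ∀ {m} → Matrix m → ℕ → Bool
minAt {m} B j with j <? m
... | yes j<m = ⌊ isMinimal? B (fromℕ< j<m) ⌋
... | no _ = false

-- The composite A ∘^{max,min}_i B, of order n + m - 1, written with 0-based
-- indices; p = toℕ i is the 0-based position of the paper's i.  Rows/columns
--   s < p          : block 1 (A-index s)          -- A_11 part, {1..i-1}
--   p ≤ s < p + m  : block 2 (B-index s - p)
--   p + m ≤ s      : block 3 (A-index s - m + 1)  -- A_22 part, {i+1..n}
-- Block entries:
--   (1,1) A_11        (1,2) O           (1,3) O
--   (2,1) Max_i(A,B)  (2,2) B           (2,3) O
--   (3,1) A_21        (3,2) Min_i(A,B)  (3,3) A_22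
-- with Max_i(A,B)[j][t] = A[p][t] if j maximal in B, else 0, and
--      Min_i(A,B)[r][j] = A[r][p] if j minimal in B, else 0.
composeEntry : ∀ {n m} → Matrix n → Matrix m → (p s t : ℕ) → Bool
composeEntry {n} {m} A B p s t with s <? p | s <? p + m | t <? p | t <? p + m
... | yes _ | _     | yes _ | _     = at A s t
... | yes _ | _     | no _  | _     = false
... | no _  | yes _ | yes _ | _     = if maxAt B (s ∸ p) then at A p t else false
... | no _  | yes _ | no _  | yes _ = at B (s ∸ p) (t ∸ p)
... | no _  | yes _ | no _  | no _  = false
... | no _  | no _  | yes _ | _     = at A (s ∸ m + 1) t
... | no _  | no _  | no _  | yes _ = if minAt B (t ∸ p) then at A (s ∸ m + 1) p else false
... | no _  | no _  | no _  | no _  = at A (s ∸ m + 1) (t ∸ m + 1)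

compose : ∀ {n m} → Matrix n → Matrix m → Fin n → Matrix (n + m ∸ 1)
compose A B i s t = composeEntry A B (toℕ i) (toℕ s) (toℕ t)

{-# OPTIONS --safe #-}
-- Split the indices of the composite into the elements of A before i, the elements of B, and the
-- elements of A after i. The only
-- chains mixing the blocks are t ≤ j ≤ r with t before i, j in B and r after i, which holds
-- because t ≤ i ≤ r in A, and chains t ≤ j ≤ j′ or j′ ≤ j ≤ r with j, j′ in B, where the
-- maximality, resp. minimality, of j forces j′ = j.
module Submission where

open import Data.Bool using (Bool; true; false; if_then_else_)
open import Data.Bool.Properties using (T-≡)
open import Data.Fin using (Fin; toℕ)
open import Data.Fin.Properties using (_≟_; toℕ<n; toℕ-fromℕ<; fromℕ<-injective)
open import Data.Nat using (ℕ; zero; suc; _+_; _∸_; _<_; _≤_; s<s)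
open import Data.Nat.Properties
  using (_<?_; ≮⇒≥; <⇒≱; <⇒≤; ≤-trans; <-trans; <-≤-trans; m≤m+n; m≤n+m;
         +-comm; +-cancelʳ-≤; ∸-monoˡ-<; m∸n≤m; m+n∸m≡n; module ≤-Reasoning)
open import Data.Product using (_×_; _,_)
open import Function using (_∘_; flip)
open import Function.Bundles using (Equivalence)
open import Relation.Binary.PropositionalEquality using (_≡_; refl; sym; trans; subst; subst₂)
open import Relation.Nullary using (yes; no; contradiction)
open import Relation.Nullary.Decidable using (toWitness)

open import Defs

m<n+o⇒m∸n<o′ : ∀ {m n o} → n ≤ m → m < n + o → m ∸ n < o
m<n+o⇒m∸n<o′ {m} {n} {o} n≤m m<n+o = subst (m ∸ n <_) (m+n∸m≡n n o) (∸-monoˡ-< m<n+o n≤m)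

m<n+o∸1⇒m∸o+1<n : ∀ {m n o} → o ≤ m → m < n + o ∸ 1 → m ∸ o + 1 < n
m<n+o∸1⇒m∸o+1<n {m} {zero}  {o} o≤m m<o∸1 = contradiction o≤m (<⇒≱ (<-≤-trans m<o∸1 (m∸n≤m o 1)))
m<n+o∸1⇒m∸o+1<n {m} {suc n} {o} o≤m m<n+o = begin-strict
  m ∸ o + 1    ≡⟨ +-comm (m ∸ o) 1 ⟩
  suc (m ∸ o)  <⟨ s<s (m<n+o⇒m∸n<o′ o≤m (subst (m <_) (+-comm n o) m<n+o)) ⟩
  suc n        ∎
  where open ≤-Reasoning

m∸o≤n∸o⇒m≤n : ∀ {m n o} → o ≤ n → m ∸ o ≤ n ∸ o → m ≤ n
m∸o≤n∸o⇒m≤n o≤n m∸o≤n∸o = ≮⇒≥ (λ n<m → <⇒≱ (∸-monoˡ-< n<m o≤n) m∸o≤n∸o)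

maximal-unique : ∀ {m} {B : Matrix m} {j k} → IsMaximal B j → B k j ≡ true → k ≡ j
maximal-unique {j = j} {k} isMax Bkj with k ≟ j
... | yes k≡j = k≡j
... | no k≢j  = contradiction (trans (sym (isMax k k≢j)) Bkj) λ ()

minimal-unique : ∀ {m} {B : Matrix m} {j k} → IsMinimal B j → B j k ≡ true → k ≡ j
minimal-unique {B = B} = maximal-unique {B = flip B}

module _ {n} {A : Matrix n} where

  at-lower : LowerTriangular A → ∀ {s t} → at A s t ≡ true → t ≤ s
  at-lower lowA {s} {t} with s <? n | t <? n
  ... | yes s<n | yes t<n = subst₂ _≤_ (toℕ-fromℕ< t<n) (toℕ-fromℕ< s<n) ∘ lowA _ _
  ... | yes _   | no _    = λ ()
  ... | no _    | _       = λ ()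

  at-refl : UnitDiagonal A → ∀ {s} → s < n → at A s s ≡ true
  at-refl diagA {s} s<n with s <? n
  ... | yes _   = diagA _
  ... | no s≮n  = contradiction s<n s≮n

  at-trans : Transitive A → ∀ {s t u} → at A s t ≡ true → at A t u ≡ true → at A s u ≡ true
  at-trans transA {s} {t} {u} with s <? n | t <? n | u <? n
  ... | yes _ | yes _ | yes _ = transA _ _ _
  ... | yes _ | yes _ | no _  = λ _ ()
  ... | yes _ | no _  | _     = λ ()
  ... | no _  | _     | _     = λ ()

module _ {m} {B : Matrix m} where

  maxAt-unique : ∀ {j k} → maxAt B j ≡ true → at B k j ≡ true → k ≡ j
  maxAt-unique {j} {k} with k <? m | j <? m
  ... | yes k<m | yes j<m = λ isMax →
    fromℕ<-injective k j k<m j<m ∘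
      maximal-unique {B = B} (toWitness {a? = isMaximal? B _} (Equivalence.from T-≡ isMax))
  ... | no _    | yes _   = λ _ ()
  ... | _       | no _    = λ ()

  minAt-unique : ∀ {j k} → minAt B j ≡ true → at B j k ≡ true → k ≡ j
  minAt-unique {j} {k} with j <? m | k <? m
  ... | yes j<m | yes k<m = λ isMin →
    fromℕ<-injective k j k<m j<m ∘
      minimal-unique {B = B} (toWitness {a? = isMinimal? B _} (Equivalence.from T-≡ isMin))
  ... | yes _   | no _    = λ _ ()
  ... | no _    | _       = λ ()

if-else-false⁻ : ∀ {b x} → (if b then x else false) ≡ true → b ≡ true × x ≡ true
if-else-false⁻ {true} x≡true = refl , x≡true
if-else-false⁻ {false} ()

if-else-false⁺ : ∀ {b x} → b ≡ true → x ≡ true → (if b then x else false) ≡ true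
if-else-false⁺ refl x≡true = x≡true

data Block (p m s : ℕ) : Set where
  before : s < p → Block p m s
  inside : p ≤ s → s < p + m → Block p m s
  after  : p + m ≤ s → Block p m s

block : ∀ p m s → Block p m s
block p m s with s <? p | s <? p + m
... | yes s<p  | _          = before s<p
... | no s≮p   | yes s<p+m  = inside (≮⇒≥ s≮p) s<p+m
... | no _     | no s≮p+m   = after (≮⇒≥ s≮p+m)

module Composite {n m} (A : Matrix n) (B : Matrix m) (p : ℕ) where

  blockEntry : ∀ {s t} → Block p m s → Block p m t → Bool
  blockEntry {s} {t} (before _)   (before _)   = at A s t
  blockEntry         (before _)   (inside _ _) = false
  blockEntry         (before _)   (after _)    = false
  blockEntry {s} {t} (inside _ _) (before _)   = if maxAt B (s ∸ p) then at A p t else false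
  blockEntry {s} {t} (inside _ _) (inside _ _) = at B (s ∸ p) (t ∸ p)
  blockEntry         (inside _ _) (after _)    = false
  blockEntry {s} {t} (after _)    (before _)   = at A (s ∸ m + 1) t
  blockEntry {s} {t} (after _)    (inside _ _) = if minAt B (t ∸ p) then at A (s ∸ m + 1) p else false
  blockEntry {s} {t} (after _)    (after _)    = at A (s ∸ m + 1) (t ∸ m + 1)

  composeEntry-blocks : ∀ s t → composeEntry A B p s t ≡ blockEntry (block p m s) (block p m t)
  composeEntry-blocks s t with s <? p | s <? p + m | t <? p | t <? p + m
  ... | yes _ | _     | yes _ | _     = refl
  ... | yes _ | _     | no _  | yes _ = refl
  ... | yes _ | _     | no _  | no _  = refl
  ... | no _  | yes _ | yes _ | _     = refl
  ... | no _  | yes _ | no _  | yes _ = refl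
  ... | no _  | yes _ | no _  | no _  = refl
  ... | no _  | no _  | yes _ | _     = refl
  ... | no _  | no _  | no _  | yes _ = refl
  ... | no _  | no _  | no _  | no _  = refl

  blockEntry-lower : LowerTriangular A → LowerTriangular B →
                     ∀ {s t} (bs : Block p m s) (bt : Block p m t) → blockEntry bs bt ≡ true → t ≤ s
  blockEntry-lower lowA lowB (before _)     (before _)       = at-lower lowA
  blockEntry-lower lowA lowB (inside p≤s _) (before t<p)     = λ _ → ≤-trans (<⇒≤ t<p) p≤s
  blockEntry-lower lowA lowB (inside p≤s _) (inside _ _)     = m∸o≤n∸o⇒m≤n p≤s ∘ at-lower lowB
  blockEntry-lower lowA lowB (after p+m≤s)  (before t<p)     =
    λ _ → ≤-trans (<⇒≤ t<p) (≤-trans (m≤m+n p m) p+m≤s)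
  blockEntry-lower lowA lowB (after p+m≤s)  (inside _ t<p+m) = λ _ → ≤-trans (<⇒≤ t<p+m) p+m≤s
  blockEntry-lower lowA lowB (after p+m≤s)  (after _)        =
    m∸o≤n∸o⇒m≤n (≤-trans (m≤n+m m p) p+m≤s) ∘ +-cancelʳ-≤ 1 _ _ ∘ at-lower lowA
  blockEntry-lower lowA lowB (before _)     (inside _ _)     = λ ()
  blockEntry-lower lowA lowB (before _)     (after _)        = λ ()
  blockEntry-lower lowA lowB (inside _ _)   (after _)        = λ ()

  blockEntry-refl : UnitDiagonal A → UnitDiagonal B → p < n →
                    ∀ {s} → s < n + m ∸ 1 → (bs : Block p m s) → blockEntry bs bs ≡ true
  blockEntry-refl diagA diagB p<n s<n+m∸1 (before s<p)       = at-refl diagA (<-trans s<p p<n)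
  blockEntry-refl diagA diagB p<n s<n+m∸1 (inside p≤s s<p+m) = at-refl diagB (m<n+o⇒m∸n<o′ p≤s s<p+m)
  blockEntry-refl diagA diagB p<n s<n+m∸1 (after p+m≤s)      =
    at-refl diagA (m<n+o∸1⇒m∸o+1<n (≤-trans (m≤n+m m p) p+m≤s) s<n+m∸1)

  blockEntry-trans : Transitive A → Transitive B →
                     ∀ {s t u} (bs : Block p m s) (bt : Block p m t) (bu : Block p m u) →
                     blockEntry bs bt ≡ true → blockEntry bt bu ≡ true → blockEntry bs bu ≡ true
  blockEntry-trans transA transB (before _) (before _) (before _) = at-trans transA
  blockEntry-trans transA transB (inside _ _) (before _) (before _) = λ s≤t t≤u →
    let sMax , p≤t = if-else-false⁻ s≤t in if-else-false⁺ sMax (at-trans transA p≤t t≤u)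
  blockEntry-trans transA transB (inside _ _) (inside _ _) (before _) = λ s≤t t≤u →
    let tMax , p≤u = if-else-false⁻ t≤u
        s≡t        = maxAt-unique {B = B} tMax s≤t
    in if-else-false⁺ (subst (λ j → maxAt B j ≡ true) (sym s≡t) tMax) p≤u
  blockEntry-trans transA transB (inside _ _) (inside _ _) (inside _ _) = at-trans transB
  blockEntry-trans transA transB (after _) (before _) (before _) = at-trans transA
  blockEntry-trans transA transB (after _) (inside _ _) (before _) = λ s≤t t≤u →
    let _ , s≤p = if-else-false⁻ s≤t
        _ , p≤u = if-else-false⁻ t≤u
    in at-trans transA s≤p p≤u
  blockEntry-trans transA transB (after _) (inside _ _) (inside _ _) = λ s≤t t≤u →
    let tMin , s≤p = if-else-false⁻ s≤t
        u≡t        = minAt-unique {B = B} tMin t≤u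
    in if-else-false⁺ (subst (λ j → minAt B j ≡ true) (sym u≡t) tMin) s≤p
  blockEntry-trans transA transB (after _) (after _) (before _) = at-trans transA
  blockEntry-trans transA transB (after _) (after _) (inside _ _) = λ s≤t t≤u →
    let uMin , t≤p = if-else-false⁻ t≤u in if-else-false⁺ uMin (at-trans transA s≤t t≤p)
  blockEntry-trans transA transB (after _) (after _) (after _) = at-trans transA
  blockEntry-trans transA transB (before _) (inside _ _) _ = λ ()
  blockEntry-trans transA transB (before _) (after _) _ = λ ()
  blockEntry-trans transA transB (inside _ _) (after _) _ = λ ()
  blockEntry-trans transA transB _ (before _) (inside _ _) = λ _ ()
  blockEntry-trans transA transB _ (before _) (after _) = λ _ ()
  blockEntry-trans transA transB _ (inside _ _) (after _) = λ _ ()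

  composeEntry-lower : LowerTriangular A → LowerTriangular B →
                       ∀ s t → composeEntry A B p s t ≡ true → t ≤ s
  composeEntry-lower lowA lowB s t rewrite composeEntry-blocks s t =
    blockEntry-lower lowA lowB (block p m s) (block p m t)

  composeEntry-refl : UnitDiagonal A → UnitDiagonal B → p < n →
                      ∀ {s} → s < n + m ∸ 1 → composeEntry A B p s s ≡ true
  composeEntry-refl diagA diagB p<n {s} s<n+m∸1 rewrite composeEntry-blocks s s =
    blockEntry-refl diagA diagB p<n s<n+m∸1 (block p m s)

  composeEntry-trans : Transitive A → Transitive B → ∀ s t u →
                       composeEntry A B p s t ≡ true → composeEntry A B p t u ≡ true →
                       composeEntry A B p s u ≡ true
  composeEntry-trans transA transB s t u
    rewrite composeEntry-blocks s t | composeEntry-blocks t u | composeEntry-blocks s u =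
    blockEntry-trans transA transB (block p m s) (block p m t) (block p m u)

theorem5 : ∀ {n m : ℕ} (A : Matrix n) (B : Matrix m) → IsPosetMatrix A → IsPosetMatrix B →
    (i : Fin n) → IsPosetMatrix (compose A B i)
theorem5 A B (lowA , diagA , transA) (lowB , diagB , transB) i =
    (λ s t → composeEntry-lower lowA lowB (toℕ s) (toℕ t))
  , (λ s → composeEntry-refl diagA diagB (toℕ<n i) (toℕ<n s))
  , (λ s t u → composeEntry-trans transA transB (toℕ s) (toℕ t) (toℕ u))
  where open Composite A B (toℕ i)
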